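{- Let $\mathfrak{F}=(X,\upharpoonleft,Y,T)$ be an implicative frame, $\mathfrak{F}^+$ its full complex algebra, $R_\leq$ the upper bound relation on $X$ and $R^{111}$ the derived relation. For arbitrary $x,z\in X$: (1) $\Gamma x\cap\Gamma z\subseteq\Gamma x\,\overline{\odot}\,\Gamma z$ iff $R_\leq xz\subseteq R^{111}xz$; (2) $\Gamma x\,\overline{\odot}\,\Gamma z\subseteq\Gamma x\cap\Gamma z$ iff $R^{111}xz\subseteq R_\leq xz$; (3) $\mathfrak{F}^+$ is a complete Heyting algebra in which $\Rightarrow$ is residuated with intersection iff $R^{111}xz=R_\leq xz$ (for all $x,z\in X$).
   Context: A sorted frame (polarity) is $(X,\upharpoonleft,Y)$ with $X,Y$ nonempty and ${\upharpoonleft}\subseteq X\times Y$. For $U\subseteq X$, $V\subseteq Y$: $U^{\perp}=\{y:\forall x\in U\ x\upharpoonleft y\}$, ${}^{\perp}V=\{x:\forall y\in V\ x\upharpoonleft y\}$. Stable sets $A={}^{\perp}(A^{\perp})$ form the complete lattice $\mathcal{G}(X)$, co-stable sets $B=({}^{\perp}B)^{\perp}$ form $\mathcal{G}(Y)$; for $W\subseteq X$, $W'=W^\perp$, for $W\subseteq Y$, $W'={}^\perp W$. Orders: $x\leq z$ iff $\{x\}^\perp\subseteq\{z\}^\perp$ on $X$, $y\leq v$ iff ${}^\perp\{y\}\subseteq{}^\perp\{v\}$ on $Y$; $\Gamma u=\{w:u\leq w\}$. For $T\subseteq Y\times X\times Y$, $T'$ is given by $uT'xv$ iff $\forall y(yTxv\Rightarrow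 u\upharpoonleft y)$. An implicative frame satisfies: (F0) $x\upharpoonleft y$ iff $uT'xy$ for all $u\in X$; (F1) the orders are partial orders; (F2) each $\{y:yTxv\}$ equals $\Gamma w$ for some $w\in Y$; (F3) $yTxv$, $x_1\leq x$, $v_1\leq v$ imply $yTx_1v_1$; (F4) for all $z,x\in X$, $v\in Y$, the sets $\{x_1:zT'x_1v\}$, $\{v_1:zT'xv_1\}$ are Galois sets. Derived relations: $vR^{\partial11}zx$ iff $xT'zv$; $uR^{111}zx$ iff $\forall v\in Y(vR^{\partial11}zx\Rightarrow u\upharpoonleft v)$. Upper bound relation: $uR_\leq xz$ iff $x\leq u$ and $z\leq u$. For a ternary relation $R$ on $X$, $Rxz=\{u: uRxz\}$. Full complex algebra $\mathfrak{F}^+=(\mathcal{G}(X),\subseteq,\bigcap,\bigvee,\emptyset,X,\overline{\odot},\Rightarrow)$ with $A\Rightarrow C={}^\perp\big((\{y:\exists x\in A\,\exists v\in C^\perp\ yTxv\})''\big)$ and $A\,\overline{\odot}\,F=(\{u:\exists z\in A\,\exists x\in F\ uR^{111}zx\})''$. -}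

module Defs where

open import Level using (0ℓ)
open import Data.Product using (Σ; ∃; _×_; _,_)
open import Relation.Binary.PropositionalEquality using (_≡_)
open import Relation.Unary using (Pred; _⊆_; _∩_; _≐_)
open import Function.Bundles using (_⇔_)

record Frame : Set₁ where
  field
    X : Set
    Y : Set
    _↿_ : X → Y → Set
    T : Y → X → Y → Set
    x₀ : X
    y₀ : Y

module FrameDefs (𝔉 : Frame) where
  open Frame 𝔉 public

  _⊥ : Pred X 0ℓ → Pred Y 0ℓ
  (U ⊥) y = ∀ x → U x → x ↿ y

  ⊥_ : Pred Y 0ℓ → Pred X 0ℓ
  (⊥ V) x = ∀ y → V y → x ↿ y

  Stable : Pred X 0ℓ → Set
  Stable A = A ≐ ⊥ (A ⊥)

  CoStable : Pred Y 0ℓ → Set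
  CoStable B = B ≐ (⊥ B) ⊥

  clX : Pred X 0ℓ → Pred X 0ℓ
  clX W = ⊥ (W ⊥)

  clY : Pred Y 0ℓ → Pred Y 0ℓ
  clY W = (⊥ W) ⊥

  _≤X_ : X → X → Set
  x ≤X z = ∀ y → x ↿ y → z ↿ y

  _≤Y_ : Y → Y → Set
  y ≤Y v = ∀ x → x ↿ y → x ↿ v

  ΓX : X → Pred X 0ℓ
  ΓX u w = u ≤X w

  ΓY : Y → Pred Y 0ℓ
  ΓY u w = u ≤Y w

  T′ : X → X → Y → Set
  T′ u x v = ∀ y → T y x v → u ↿ y

  R∂11 : Y → X → X → Set
  R∂11 v z x = T′ x z v

  R111 : X → X → X → Set
  R111 u z x = ∀ v → R∂11 v z x → u ↿ v

  R≤ : X → X → X → Set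
  R≤ u x z = (x ≤X u) × (z ≤X u)

  sect : (X → X → X → Set) → X → X → Pred X 0ℓ
  sect R x z u = R u x z

  _⇒_ : Pred X 0ℓ → Pred X 0ℓ → Pred X 0ℓ
  A ⇒ C = ⊥ (clY (λ y → Σ X λ x → A x × Σ Y λ v → (C ⊥) v × T y x v))

  _⊙_ : Pred X 0ℓ → Pred X 0ℓ → Pred X 0ℓ
  A ⊙ F = clX (λ u → Σ X λ z → A z × Σ X λ x → F x × R111 u z x)

  record IsImplicative : Set where
    field
      F0 : ∀ x y → (x ↿ y) ⇔ (∀ u → T′ u x y)
      F1X : ∀ x z → x ≤X z → z ≤X x → x ≡ z
      F1Y : ∀ y v → y ≤Y v → v ≤Y y → y ≡ v
      F2 : ∀ x v → ∃ λ w → (λ y → T y x v) ≐ ΓY w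
      F3 : ∀ y x v x₁ v₁ → T y x v → x₁ ≤X x → v₁ ≤Y v → T y x₁ v₁
      F4X : ∀ z v → Stable (λ x₁ → T′ z x₁ v)
      F4Y : ∀ z x → CoStable (λ v₁ → T′ z x v₁)

{-# OPTIONS --safe #-}
-- Γx ⊙ Γz is the stable set R¹¹¹xz, whereas Γx ∩ Γz is literally R≤xz; this gives (1) and (2).
-- For (3): ⊙ is always left adjoint to ⇒ on stable sets (axiom F4), so ⇒ is residuated with ∩
-- iff ∩ and ⊙ agree on stable sets. Agreement on the principal sets Γx, Γz is R¹¹¹ = R≤, and
-- conversely R¹¹¹ = R≤ forces agreement everywhere because stable sets are upward closed.
module Submission where

open import Defs
open import Level using (Level; 0ℓ)
open import Data.Product using (_×_; _,_; proj₁; proj₂; Σ)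
open import Relation.Unary using (Pred; _⊆_; _∩_; _≐_)
open import Relation.Unary.Properties using (≐-trans; ≐-sym)
open import Function.Bundles using (_⇔_; mk⇔; Equivalence)
import Function.Properties.Equivalence as ⇔

private
  variable
    a ℓ₁ ℓ₂ ℓ₃ : Level
    I : Set a

⊆-congˡ-⇔ : {P : Pred I ℓ₁} {Q : Pred I ℓ₂} {S : Pred I ℓ₃} → P ≐ Q → (P ⊆ S) ⇔ (Q ⊆ S)
⊆-congˡ-⇔ (P⊆Q , Q⊆P) = mk⇔ (λ P⊆S {_} q → P⊆S (Q⊆P q)) (λ Q⊆S {_} p → Q⊆S (P⊆Q p))

⊆-congʳ-⇔ : {P : Pred I ℓ₁} {Q : Pred I ℓ₂} {S : Pred I ℓ₃} → P ≐ Q → (S ⊆ P) ⇔ (S ⊆ Q)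
⊆-congʳ-⇔ (P⊆Q , Q⊆P) = mk⇔ (λ S⊆P {_} s → P⊆Q (S⊆P s)) (λ S⊆Q {_} s → Q⊆P (S⊆Q s))

module ComplexAlgebra (𝔉 : Frame) where
  open FrameDefs 𝔉

  ≤X-refl : ∀ {x} → x ≤X x
  ≤X-refl y x↿y = x↿y

  ⊥-stable : ∀ V → Stable (⊥ V)
  ⊥-stable V = (λ {u} u∈⊥V y h → h u u∈⊥V) , (λ h y y∈V → h y (λ x x∈⊥V → x∈⊥V y y∈V))

  ΓX-stable : ∀ x → Stable (ΓX x)
  ΓX-stable x = ⊥-stable (x ↿_)

  ⊥-clY : ∀ V → ⊥ (clY V) ≐ ⊥ V
  ⊥-clY V = ≐-sym (⊥-stable V)

  ⊆-clX : ∀ {W} → W ⊆ clX W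
  ⊆-clX {_} {u} u∈W y h = h u u∈W

  clX-least : ∀ {W A} → Stable A → W ⊆ A → clX W ⊆ A
  clX-least stA W⊆A {u} u∈clW = proj₂ stA (λ y y∈A⊥ → u∈clW y (λ w w∈W → y∈A⊥ w (W⊆A w∈W)))

  Stable⇒upwardClosed : ∀ {A} → Stable A → ∀ {z u} → A z → z ≤X u → A u
  Stable⇒upwardClosed stA z∈A z≤u = proj₂ stA (λ y y∈A⊥ → z≤u y (y∈A⊥ _ z∈A))

  ∩-stable : ∀ {A F} → Stable A → Stable F → Stable (A ∩ F)
  ∩-stable stA stF =
    (λ {u} u∈A∩F y h → h u u∈A∩F) ,
    (λ u∈cl → clX-least stA proj₁ u∈cl , clX-least stF proj₂ u∈cl)

  ⊙-generators : Pred X 0ℓ → Pred X 0ℓ → Pred X 0ℓ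
  ⊙-generators A F u = Σ X λ z → A z × Σ X λ x → F x × R111 u z x

  ⇒-generators : Pred X 0ℓ → Pred X 0ℓ → Pred Y 0ℓ
  ⇒-generators A C y = Σ X λ x → A x × Σ Y λ v → (C ⊥) v × T y x v

  ⊙-stable : ∀ A F → Stable (A ⊙ F)
  ⊙-stable A F = ⊥-stable (⊙-generators A F ⊥)

  R111-antitone : (∀ y x v x₁ → T y x v → x₁ ≤X x → T y x₁ v) →
                  ∀ {u z x z′ x′} → z ≤X z′ → x ≤X x′ → R111 u z′ x′ → R111 u z x
  R111-antitone T-antitone z≤z′ x≤x′ r v t′ =
    r v (λ y t → x≤x′ y (t′ y (T-antitone y _ v _ t z≤z′)))

  ΓX-⊙-ΓX : (∀ y x v x₁ → T y x v → x₁ ≤X x → T y x₁ v) →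
            ∀ x z → (ΓX x ⊙ ΓX z) ≐ sect R111 x z
  ΓX-⊙-ΓX T-antitone x z =
    clX-least (⊥-stable _) (λ (_ , x≤z′ , _ , z≤x′ , r) → R111-antitone T-antitone x≤z′ z≤x′ r) ,
    (λ r → ⊆-clX (x , ≤X-refl , z , ≤X-refl , r))

  -- Co-stability of T′ x z _ turns "every u with uR¹¹¹zx lies in C" into "x T′-relates z to C⊥".
  ⊙-⇒-residuated : (∀ z x → CoStable (λ v₁ → T′ z x v₁)) →
                   ∀ A F C → Stable C → ((A ⊙ F) ⊆ C) ⇔ (F ⊆ (A ⇒ C))
  ⊙-⇒-residuated F4Y A F C stC = mk⇔ adjoint⇒ adjoint⇐
    where
    adjoint⇒ : (A ⊙ F) ⊆ C → F ⊆ (A ⇒ C)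
    adjoint⇒ A⊙F⊆C {x} x∈F = proj₂ (⊥-clY (⇒-generators A C))
      (λ y (z , z∈A , v , v∈C⊥ , t) →
        proj₂ (F4Y x z) (λ u r → v∈C⊥ u (A⊙F⊆C (⊆-clX (z , z∈A , x , x∈F , r)))) y t)

    adjoint⇐ : F ⊆ (A ⇒ C) → (A ⊙ F) ⊆ C
    adjoint⇐ F⊆A⇒C = clX-least stC λ (z , z∈A , x , x∈F , r) →
      proj₂ stC (λ v v∈C⊥ → r v (λ y t →
        proj₁ (⊥-clY (⇒-generators A C)) (F⊆A⇒C x∈F) y (z , z∈A , v , v∈C⊥ , t)))

  ∩-⇒-Residuated : Set₁
  ∩-⇒-Residuated = ∀ A F C → Stable A → Stable F → Stable C → ((A ∩ F) ⊆ C) ⇔ (F ⊆ (A ⇒ C))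

  R111≐R≤ : Set
  R111≐R≤ = ∀ x z → sect R111 x z ≐ sect R≤ x z

  R111≐R≤⇒⊙≐∩ : R111≐R≤ → ∀ {A F} → Stable A → Stable F → (A ⊙ F) ≐ (A ∩ F)
  R111≐R≤⇒⊙≐∩ E stA stF =
    clX-least (∩-stable stA stF)
      (λ (z , z∈A , x , x∈F , r) → let z≤u , x≤u = proj₁ (E z x) r in
        Stable⇒upwardClosed stA z∈A z≤u , Stable⇒upwardClosed stF x∈F x≤u) ,
    (λ {u} (u∈A , u∈F) → ⊆-clX (u , u∈A , u , u∈F , proj₂ (E u u) (≤X-refl , ≤X-refl)))

  stable-≐-byUpperBounds : ∀ {P Q} → Stable P → Stable Q →
                           (∀ C → Stable C → (P ⊆ C) ⇔ (Q ⊆ C)) → P ≐ Q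
  stable-≐-byUpperBounds {P} {Q} stP stQ H =
    Equivalence.from (H Q stQ) (λ q → q) , Equivalence.to (H P stP) (λ p → p)

proposition3p14 : (𝔉 : Frame) → FrameDefs.IsImplicative 𝔉 →
    let open FrameDefs 𝔉 in
    (∀ x z → ((ΓX x ∩ ΓX z) ⊆ (ΓX x ⊙ ΓX z)) ⇔ (sect R≤ x z ⊆ sect R111 x z))
    × (∀ x z → ((ΓX x ⊙ ΓX z) ⊆ (ΓX x ∩ ΓX z)) ⇔ (sect R111 x z ⊆ sect R≤ x z))
    × ((∀ A F C → Stable A → Stable F → Stable C → ((A ∩ F) ⊆ C) ⇔ (F ⊆ (A ⇒ C)))
    ⇔ (∀ x z → sect R111 x z ≐ sect R≤ x z))
proposition3p14 𝔉 imp =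
    (λ x z → ⊆-congʳ-⇔ (Γ⊙Γ≐R111 x z))
  , (λ x z → ⊆-congˡ-⇔ (Γ⊙Γ≐R111 x z))
  , mk⇔ residuated⇒R111≐R≤ R111≐R≤⇒residuated
  where
  open FrameDefs 𝔉
  open IsImplicative imp
  open ComplexAlgebra 𝔉

  Γ⊙Γ≐R111 : ∀ x z → (ΓX x ⊙ ΓX z) ≐ sect R111 x z
  Γ⊙Γ≐R111 = ΓX-⊙-ΓX (λ y x v x₁ t x₁≤x → F3 y x v x₁ v t x₁≤x (λ _ p → p))

  residuated⇒R111≐R≤ : ∩-⇒-Residuated → R111≐R≤
  residuated⇒R111≐R≤ H x z = ≐-trans (≐-sym (Γ⊙Γ≐R111 x z))
    (stable-≐-byUpperBounds (⊙-stable _ _) (∩-stable (ΓX-stable x) (ΓX-stable z)) λ C stC →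
      ⇔.trans (⊙-⇒-residuated F4Y _ _ C stC) (⇔.sym (H _ _ C (ΓX-stable x) (ΓX-stable z) stC)))

  R111≐R≤⇒residuated : R111≐R≤ → ∩-⇒-Residuated
  R111≐R≤⇒residuated E A F C stA stF stC =
    ⇔.trans (⊆-congˡ-⇔ (≐-sym (R111≐R≤⇒⊙≐∩ E stA stF))) (⊙-⇒-residuated F4Y A F C stC)
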